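{- Let $(a,b)\in\mathbb F_q^2$ and $\lambda\in\mathbb F_q^*$. If $1+\lambda^2$ is a nonzero square in $\mathbb F_q$, then the line $L_\lambda(a,b)=\{(x_1+a,x_2+b)\in\mathbb F_q^2: x_2=\lambda x_1\}$ is a $1$-coordinatable plane in $\mathbb F_q^2$.
   Context: $q$ is an odd prime power. A rotation of $\mathbb F_q^2$ is $x\mapsto Rx$ with $R$ a $2\times2$ matrix over $\mathbb F_q$ with $R^\top R=I$ and $\det R=1$; a translation is $x\mapsto x+v$. A line in $\mathbb F_q^2$ is a $1$-coordinatable plane if it can be mapped by a rotation and a translation onto one of the coordinate axes $\{(x_1,0)\}$ or $\{(0,x_2)\}$. -}

module Defs where

open import Level using (_⊔_)
open import Algebra.Bundles using (CommutativeRing)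
open import Data.Nat using (ℕ; suc; _^_; _%_)
open import Data.Nat.Primality using (Prime)
open import Data.Fin using (Fin)
open import Data.Product using (Σ; ∃; _×_; _,_)
open import Relation.Binary.PropositionalEquality using (_≡_)
open import Relation.Nullary using (¬_)

IsField : ∀ {c ℓ} → CommutativeRing c ℓ → Set (c ⊔ ℓ)
IsField F = (¬ (1# ≈ 0#)) × (∀ x → ¬ (x ≈ 0#) → ∃ λ y → x * y ≈ 1#)
  where open CommutativeRing F

HasOrder : ∀ {c ℓ} → CommutativeRing c ℓ → ℕ → Set (c ⊔ ℓ)
HasOrder F q =
  Σ (Fin q → Carrier) λ e →
    (∀ i j → e i ≈ e j → i ≡ j) × (∀ x → ∃ λ i → e i ≈ x)
  where open CommutativeRing F

IsOddPrimePower : ℕ → Set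
IsOddPrimePower q = (∃ λ p → ∃ λ k → Prime p × q ≡ p ^ suc k) × (q % 2 ≡ 1)

IsFq : ∀ {c ℓ} → CommutativeRing c ℓ → ℕ → Set (c ⊔ ℓ)
IsFq F q = IsField F × HasOrder F q × IsOddPrimePower q

module Plane {c ℓ} (F : CommutativeRing c ℓ) where
  open CommutativeRing F

  Point : Set c
  Point = Carrier × Carrier

  _≈ₚ_ : Point → Point → Set ℓ
  (x₁ , x₂) ≈ₚ (y₁ , y₂) = (x₁ ≈ y₁) × (x₂ ≈ y₂)

  Subset : Set (Level.suc (c ⊔ ℓ))
  Subset = Point → Set (c ⊔ ℓ)

  record Matrix : Set c where
    constructor mat
    field r₁₁ r₁₂ r₂₁ r₂₂ : Carrier

  apply : Matrix → Point → Point
  apply (mat r₁₁ r₁₂ r₂₁ r₂₂) (x₁ , x₂) = (r₁₁ * x₁ + r₁₂ * x₂ , r₂₁ * x₁ + r₂₂ * x₂)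

  -- R is a rotation: Rᵀ R = I and det R = 1
  IsRotation : Matrix → Set ℓ
  IsRotation (mat r₁₁ r₁₂ r₂₁ r₂₂) =
    (r₁₁ * r₁₁ + r₂₁ * r₂₁ ≈ 1#) × (r₁₁ * r₁₂ + r₂₁ * r₂₂ ≈ 0#) ×
    (r₁₂ * r₁₁ + r₂₂ * r₂₁ ≈ 0#) × (r₁₂ * r₁₂ + r₂₂ * r₂₂ ≈ 1#) ×
    (r₁₁ * r₂₂ + - (r₁₂ * r₂₁) ≈ 1#)

  motion : Matrix → Point → Point → Point
  motion R (v₁ , v₂) x with apply R x
  ... | (y₁ , y₂) = (y₁ + v₁ , y₂ + v₂)

  MapsOnto : (Point → Point) → Subset → Subset → Set (c ⊔ ℓ)
  MapsOnto f S T = (∀ y → S y → T (f y)) × (∀ z → T z → ∃ λ y → S y × (f y ≈ₚ z))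

  axis₁ : Subset
  axis₁ (x₁ , x₂) = Level.Lift c (x₂ ≈ 0#)

  axis₂ : Subset
  axis₂ (x₁ , x₂) = Level.Lift c (x₁ ≈ 0#)

  OneCoordinatable : Subset → Set (c ⊔ ℓ)
  OneCoordinatable S = ∃ λ R → ∃ λ v → IsRotation R ×
    (MapsOnto (motion R v) S axis₁ Data.Sum.⊎ MapsOnto (motion R v) S axis₂)
    where import Data.Sum

  L : Carrier → Carrier → Carrier → Subset
  L lam a b (y₁ , y₂) = ∃ λ x₁ → ∃ λ x₂ → (x₂ ≈ lam * x₁) × (y₁ ≈ x₁ + a) × (y₂ ≈ x₂ + b)

  IsNonzeroSquare : Carrier → Set (c ⊔ ℓ)
  IsNonzeroSquare u = (¬ (u ≈ 0#)) × (∃ λ t → t * t ≈ u)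

{-# OPTIONS --safe #-}
module Submission where

open import Defs
open import Algebra.Bundles using (CommutativeRing)
open import Data.Nat using (ℕ)
open import Relation.Nullary using (¬_)
open import Data.Product using (∃; _×_; _,_; proj₁; proj₂)
open import Data.Sum using (inj₁)
open import Level using (lift)
import Algebra.Properties.Ring as RingProperties
import Algebra.Solver.Ring.NaturalCoefficients.Default as NaturalCoefficientSolver
import Relation.Binary.Reasoning.Setoid as SetoidReasoning

-- If t² = 1 + λ² and s = t⁻¹, then (c , σ) = (s , s λ) lies on the unit
-- circle, and the rotation with cosine c and sine σ sends the direction
-- (1 , λ) of the line to (t , 0).  It therefore maps the line onto a
-- horizontal line, which a vertical translation moves onto the first axis.

module PlaneGeometry {c ℓ} (F : CommutativeRing c ℓ) where
  open CommutativeRing F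
  open Plane F
  open RingProperties ring
  open NaturalCoefficientSolver commutativeSemiring using (solve; _:=_; _:+_; _:*_; con)
  open SetoidReasoning setoid

  x*x≈n∧x*y≈1⇒y*y*n≈1 : ∀ {x y n} → x * x ≈ n → x * y ≈ 1# → y * y * n ≈ 1#
  x*x≈n∧x*y≈1⇒y*y*n≈1 {x} {y} {n} x*x≈n x*y≈1 = begin
    y * y * n           ≈⟨ *-congˡ x*x≈n ⟨
    y * y * (x * x)     ≈⟨ solve 2 (λ x y → y :* y :* (x :* x) := x :* y :* (x :* y)) refl x y ⟩
    x * y * (x * y)     ≈⟨ *-cong x*y≈1 x*y≈1 ⟩
    1# * 1#             ≈⟨ *-identityˡ 1# ⟩
    1#                  ∎

  square-root-nonzero : ∀ {x n} → x * x ≈ n → ¬ (n ≈ 0#) → ¬ (x ≈ 0#)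
  square-root-nonzero {x} x*x≈n n≉0 x≈0 = n≉0 (trans (sym x*x≈n) (trans (*-congʳ x≈0) (zeroˡ x)))

  rotation : Carrier → Carrier → Matrix
  rotation cos sin = mat cos sin (- sin) cos

  -[x*-y]≈x*y : ∀ x y → - (x * - y) ≈ x * y
  -[x*-y]≈x*y x y = trans (-‿cong (sym (-‿distribʳ-* x y))) (-‿involutive (x * y))

  -x*-y≈x*y : ∀ x y → - x * - y ≈ x * y
  -x*-y≈x*y x y = trans (sym (-‿distribˡ-* x (- y))) (-[x*-y]≈x*y x y)

  rotation-isRotation : ∀ {cos sin} → cos * cos + sin * sin ≈ 1# → IsRotation (rotation cos sin)
  rotation-isRotation {cos} {sin} cos²+sin²≈1 =
    trans (+-congˡ (-x*-y≈x*y sin sin)) cos²+sin²≈1 ,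
    trans (+-congˡ (sym (-‿distribˡ-* sin cos))) (x≈y⇒x∙y⁻¹≈ε (*-comm cos sin)) ,
    trans (+-congˡ (sym (-‿distribʳ-* cos sin))) (x≈y⇒x∙y⁻¹≈ε (*-comm sin cos)) ,
    trans (+-comm (sin * sin) (cos * cos)) cos²+sin²≈1 ,
    trans (+-congˡ (-[x*-y]≈x*y sin sin)) cos²+sin²≈1

  rotation-direction : ∀ cos lam → apply (rotation cos (cos * lam)) (1# , lam) ≈ₚ (cos * (1# + lam * lam) , 0#)
  rotation-direction cos lam =
    solve 2 (λ c l → c :* con 1 :+ c :* l :* l := c :* (con 1 :+ l :* l)) refl cos lam ,
    trans (+-congʳ (*-identityʳ (- (cos * lam)))) (-‿inverseˡ (cos * lam))

  infixl 6 _+ₚ_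
  infixr 7 _·ₚ_

  _+ₚ_ : Point → Point → Point
  (x₁ , x₂) +ₚ (y₁ , y₂) = (x₁ + y₁ , x₂ + y₂)

  _·ₚ_ : Carrier → Point → Point
  k ·ₚ (x₁ , x₂) = (k * x₁ , k * x₂)

  apply-linear : ∀ R k u w → apply R (k ·ₚ u +ₚ w) ≈ₚ (k ·ₚ apply R u +ₚ apply R w)
  apply-linear (mat r₁₁ r₁₂ r₂₁ r₂₂) k (u₁ , u₂) (w₁ , w₂) = row r₁₁ r₁₂ , row r₂₁ r₂₂
    where
    row : ∀ r r′ → r * (k * u₁ + w₁) + r′ * (k * u₂ + w₂) ≈ k * (r * u₁ + r′ * u₂) + (r * w₁ + r′ * w₂)
    row r r′ = solve 7 (λ r r′ k u₁ u₂ w₁ w₂ →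
      r :* (k :* u₁ :+ w₁) :+ r′ :* (k :* u₂ :+ w₂) := k :* (r :* u₁ :+ r′ :* u₂) :+ (r :* w₁ :+ r′ :* w₂))
      refl r r′ k u₁ u₂ w₁ w₂

  motion-cong : ∀ R v {y z} → y ≈ₚ z → motion R v y ≈ₚ motion R v z
  motion-cong (mat r₁₁ r₁₂ r₂₁ r₂₂) v (y₁≈z₁ , y₂≈z₂) =
    +-congʳ (+-cong (*-congˡ y₁≈z₁) (*-congˡ y₂≈z₂)) ,
    +-congʳ (+-cong (*-congˡ y₁≈z₁) (*-congˡ y₂≈z₂))

  L-point : ∀ lam a b x → L lam a b (x ·ₚ (1# , lam) +ₚ (a , b))
  L-point lam a b x = x , x * lam , *-comm x lam , +-congʳ (*-identityʳ x) , refl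

  L-parametrised : ∀ {lam a b y} → L lam a b y → ∃ λ x → y ≈ₚ (x ·ₚ (1# , lam) +ₚ (a , b))
  L-parametrised {lam} (x₁ , x₂ , x₂≈lam*x₁ , y₁≈x₁+a , y₂≈x₂+b) =
    x₁ , trans y₁≈x₁+a (+-congʳ (sym (*-identityʳ x₁))) ,
         trans y₂≈x₂+b (+-congʳ (trans x₂≈lam*x₁ (*-comm lam x₁)))

  motion-maps-L-onto-axis₁ : ∀ R {lam u u⁻¹} a b → apply R (1# , lam) ≈ₚ (u , 0#) → u⁻¹ * u ≈ 1# →
    MapsOnto (motion R (0# , - proj₂ (apply R (a , b)))) (L lam a b) axis₁
  motion-maps-L-onto-axis₁ R {lam} {u} {u⁻¹} a b (Rd₁≈u , Rd₂≈0) u⁻¹*u≈1 = forward , backward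
    where
    d : Point
    d = (1# , lam)
    line : Carrier → Point
    line x = x ·ₚ d +ₚ (a , b)
    w₁ = proj₁ (apply R (a , b))
    w₂ = proj₂ (apply R (a , b))
    v = (0# , - w₂)

    along : ∀ x → motion R v (line x) ≈ₚ (x * u + w₁ , 0#)
    along x = first , second
      where
      linear = apply-linear R x d (a , b)
      first : proj₁ (apply R (line x)) + 0# ≈ x * u + w₁
      first = begin
        proj₁ (apply R (line x)) + 0#   ≈⟨ +-identityʳ _ ⟩
        proj₁ (apply R (line x))        ≈⟨ proj₁ linear ⟩
        x * proj₁ (apply R d) + w₁      ≈⟨ +-congʳ (*-congˡ Rd₁≈u) ⟩
        x * u + w₁                      ∎
      second : proj₂ (apply R (line x)) - w₂ ≈ 0#
      second = begin
        proj₂ (apply R (line x)) - w₂   ≈⟨ +-congʳ (proj₂ linear) ⟩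
        x * proj₂ (apply R d) + w₂ - w₂ ≈⟨ //-rightDividesʳ w₂ (x * proj₂ (apply R d)) ⟩
        x * proj₂ (apply R d)           ≈⟨ *-congˡ Rd₂≈0 ⟩
        x * 0#                          ≈⟨ zeroʳ x ⟩
        0#                              ∎

    forward : ∀ y → L lam a b y → axis₁ (motion R v y)
    forward y y∈L with L-parametrised y∈L
    ... | x , y≈line-x = lift (trans (proj₂ (motion-cong R v y≈line-x)) (proj₂ (along x)))

    backward : ∀ z → axis₁ z → ∃ λ y → L lam a b y × (motion R v y ≈ₚ z)
    backward (z₁ , z₂) (lift z₂≈0) =
      line x , L-point lam a b x , trans (proj₁ (along x)) x*u+w₁≈z₁ , trans (proj₂ (along x)) (sym z₂≈0)
      where
      x = u⁻¹ * (z₁ - w₁)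
      x*u+w₁≈z₁ : x * u + w₁ ≈ z₁
      x*u+w₁≈z₁ = begin
        u⁻¹ * (z₁ - w₁) * u + w₁ ≈⟨ +-congʳ (solve 3 (λ i d u → i :* d :* u := i :* u :* d) refl u⁻¹ (z₁ - w₁) u) ⟩
        u⁻¹ * u * (z₁ - w₁) + w₁ ≈⟨ +-congʳ (*-congʳ u⁻¹*u≈1) ⟩
        1# * (z₁ - w₁) + w₁      ≈⟨ +-congʳ (*-identityˡ (z₁ - w₁)) ⟩
        z₁ - w₁ + w₁             ≈⟨ //-rightDividesˡ w₁ z₁ ⟩
        z₁                       ∎

lemma4p4 : ∀ {c ℓ} (F : CommutativeRing c ℓ) (q : ℕ) → IsFq F q →
    (a b lam : CommutativeRing.Carrier F) →
    ¬ (CommutativeRing._≈_ F lam (CommutativeRing.0# F)) →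
    Plane.IsNonzeroSquare F (CommutativeRing._+_ F (CommutativeRing.1# F) (CommutativeRing._*_ F lam lam)) →
    Plane.OneCoordinatable F (Plane.L F lam a b)
lemma4p4 F _ ((_ , inverse) , _) a b lam _ (1+λ²≉0 , t , t*t≈1+λ²)
  with inverse t (PlaneGeometry.square-root-nonzero F t*t≈1+λ² 1+λ²≉0)
... | s , t*s≈1 =
  R , (0# , - proj₂ (apply R (a , b))) , rotation-isRotation unit-circle ,
  inj₁ (motion-maps-L-onto-axis₁ R a b (rotation-direction s lam) s*[s*[1+λ²]]≈1)
  where
  open CommutativeRing F
  open Plane F
  open PlaneGeometry F
  open NaturalCoefficientSolver commutativeSemiring using (solve; _:=_; _:+_; _:*_; con)

  R : Matrix
  R = rotation s (s * lam)

  s*s*[1+λ²]≈1 : s * s * (1# + lam * lam) ≈ 1#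
  s*s*[1+λ²]≈1 = x*x≈n∧x*y≈1⇒y*y*n≈1 t*t≈1+λ² t*s≈1

  unit-circle : s * s + s * lam * (s * lam) ≈ 1#
  unit-circle = trans (solve 2 (λ s l → s :* s :+ s :* l :* (s :* l) := s :* s :* (con 1 :+ l :* l)) refl s lam)
                      s*s*[1+λ²]≈1

  s*[s*[1+λ²]]≈1 : s * (s * (1# + lam * lam)) ≈ 1#
  s*[s*[1+λ²]]≈1 = trans (sym (*-assoc s s (1# + lam * lam))) s*s*[1+λ²]≈1
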